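{- Let $I$ be a set. For each $i\in I$, let $S_i$ be a near $e_i$ subsemigroup of a semitopological semigroup $T_i$ and let $A_i\subseteq S_i$. Let us consider the product semitopological semigroup $T=\prod_{i\in I}T_i$ with box topology. Let $S=\prod_{i\in I}S_i$, $A=\prod_{i\in I}A_i$ and $e=(e_i)_{i\in I}$. Let $e$ have a countable local base in $T$. Let $J=\{i\in I:A_i\subseteq S_i \text{ is not thick near } e_i\}$ be a finite set. Then $A\subseteq S$ is piecewise syndetic near $e$ if and only if for each $i\in I$, $A_i\subseteq S_i$ is piecewise syndetic near $e_i$.
   Context: All semitopological semigroups $(T,+)$ are Hausdorff, with $x\mapsto a+x$ and $x\mapsto x+a$ continuous. For $x\in T$, $\tau_x$ is the set of neighborhoods of $x$. For $e$ an idempotent of $T$ not in a subsemigroup $S$, $S$ is a near $e$ subsemigroup of $T$ if $e\in cl_T(S)$. The box topology on $\prod_{i\in I}T_i$ is generated by the sets $\prod_{i\in I}U_i$ with each $U_i$ open in $T_i$. A set $A\subseteq S$ is thick near $e$ if there exists $U\in\tau_e$ such that for each finite nonempty $F\subseteq U\cap S$ and each $V\in\tau_e$ there is $x\in V\cap S$ with $F+x\subseteq A$. If $e$ has a countable (decreasing) local base $\langle W_n\rangle_{n=1}^\infty$ in $T$, $A\subseteq S$ is piecewise syndetic near $e$ if there exist sequences $\langle F_n\rangle$, $\langle V_n\rangle$ with $F_n$ a finite nonempty subset of $W_n\cap S$, $V_n\in\tau_e$, $V_n\subseteq W_n$, such that for each finite nonempty $G\subseteq S$ and each $O\in\tau_e$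 there is $x\in O\cap S$ with $(G\cap V_n)+x\subseteq\bigcup_{t\in F_n}(-t+A)$ for all $n$ (here $-t+A=\{y\in S:t+y\in A\}$); this is independent of the chosen local base. -}

module Defs where

open import Level using (0ℓ)
open import Data.Nat using (ℕ; suc)
open import Data.Product using (Σ; Σ-syntax; ∃; ∃-syntax; _×_; _,_)
open import Data.List using (List; [])
open import Data.List.Relation.Unary.All using (All)
open import Data.List.Relation.Unary.Any using (Any)
open import Data.List.Membership.Propositional using (_∈_)
open import Relation.Unary using (Pred; _⊆_; _∩_; _∉_; U)
open import Relation.Binary.PropositionalEquality using (_≡_; _≢_)
open import Relation.Nullary using (¬_)
open import Data.Empty using (⊥)

record RawSTS : Set₂ where
  infixl 6 _+_
  field
    Carrier : Set
    Open    : Pred Carrier 0ℓ → Set₁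
    _+_     : Carrier → Carrier → Carrier

  Nbhd : Carrier → Pred Carrier 0ℓ → Set₁
  Nbhd x N = Σ[ U ∈ Pred Carrier 0ℓ ] (Open U × U x × U ⊆ N)

record SemitopSemigroup : Set₂ where
  field
    raw : RawSTS
  open RawSTS raw public
  field
    open-univ : Open U
    open-∩    : ∀ {U V} → Open U → Open V → Open (U ∩ V)
    open-⋃    : {K : Set} (F : K → Pred Carrier 0ℓ) → (∀ k → Open (F k)) →
                Open (λ x → Σ[ k ∈ K ] F k x)
    hausdorff : ∀ {x y} → x ≢ y →
                Σ[ U ∈ Pred Carrier 0ℓ ] Σ[ V ∈ Pred Carrier 0ℓ ]
                  (Open U × Open V × U x × V y × (∀ z → U z → V z → ⊥))
    +-assoc   : ∀ x y z → (x + y) + z ≡ x + (y + z)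
    left-cont  : ∀ a U → Open U → Open (λ x → U (a + x))
    right-cont : ∀ a U → Open U → Open (λ x → U (x + a))

module _ (T : RawSTS) where
  open RawSTS T

  -- finite nonempty subsets of a set P, represented by nonempty lists
  FinNonemptySub : Pred Carrier 0ℓ → List Carrier → Set
  FinNonemptySub P F = (F ≢ []) × All P F

  IsIdempotent : Carrier → Set
  IsIdempotent e = e + e ≡ e

  IsSubsemigroup : Pred Carrier 0ℓ → Set
  IsSubsemigroup S = ∀ {x y} → S x → S y → S (x + y)

  InClosure : Carrier → Pred Carrier 0ℓ → Set₁
  InClosure e S = ∀ N → Nbhd e N → Σ[ x ∈ Carrier ] (N x × S x)

  IsNearSubsemigroup : Carrier → Pred Carrier 0ℓ → Set₁
  IsNearSubsemigroup e S =
    IsIdempotent e × IsSubsemigroup S × e ∉ S × InClosure e S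

  IsCountableLocalBase : Carrier → (ℕ → Pred Carrier 0ℓ) → Set₁
  IsCountableLocalBase e W =
    (∀ n → Nbhd e (W n)) × (∀ n → W (suc n) ⊆ W n) ×
    (∀ N → Nbhd e N → Σ[ n ∈ ℕ ] (W n ⊆ N))

  HasCountableLocalBase : Carrier → Set₁
  HasCountableLocalBase e =
    Σ[ W ∈ (ℕ → Pred Carrier 0ℓ) ] IsCountableLocalBase e W

  ThickNear : Carrier → Pred Carrier 0ℓ → Pred Carrier 0ℓ → Set₁
  ThickNear e S A =
    Σ[ U₀ ∈ Pred Carrier 0ℓ ] (Nbhd e U₀ ×
      (∀ F → FinNonemptySub (U₀ ∩ S) F → ∀ V → Nbhd e V →
        Σ[ x ∈ Carrier ] (V x × S x × All (λ t → A (t + x)) F)))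

  PiecewiseSyndeticNearWrt : Carrier → (ℕ → Pred Carrier 0ℓ) →
                             Pred Carrier 0ℓ → Pred Carrier 0ℓ → Set₁
  PiecewiseSyndeticNearWrt e W S A =
    Σ[ F ∈ (ℕ → List Carrier) ] Σ[ V ∈ (ℕ → Pred Carrier 0ℓ) ]
      ((∀ n → FinNonemptySub (W n ∩ S) (F n)) ×
       (∀ n → Nbhd e (V n)) × (∀ n → V n ⊆ W n) ×
       (∀ G → FinNonemptySub S G → ∀ O → Nbhd e O →
         Σ[ x ∈ Carrier ] (O x × S x ×
           (∀ n → ∀ y → y ∈ G → V n y →
             Any (λ t → A (t + (y + x))) (F n)))))

  -- A ⊆ S is piecewise syndetic near e (e has a countable local base W,
  -- and the defining condition holds for W; independent of the choice of W)
  PiecewiseSyndeticNear : Carrier → Pred Carrier 0ℓ → Pred Carrier 0ℓ → Set₁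
  PiecewiseSyndeticNear e S A =
    Σ[ W ∈ (ℕ → Pred Carrier 0ℓ) ]
      (IsCountableLocalBase e W × PiecewiseSyndeticNearWrt e W S A)

BoxProduct : (I : Set) → (I → SemitopSemigroup) → RawSTS
BoxProduct I T = record
  { Carrier = (i : I) → SemitopSemigroup.Carrier (T i)
  ; Open    = λ W → ∀ x → W x →
      Σ[ O ∈ ((i : I) → Pred (SemitopSemigroup.Carrier (T i)) 0ℓ) ]
        ((∀ i → SemitopSemigroup.Open (T i) (O i)) ×
         (∀ i → O i (x i)) ×
         (∀ y → (∀ i → O i (y i)) → W y))
  ; _+_     = λ x y i → SemitopSemigroup._+_ (T i) (x i) (y i)
  }

ΠSet : (I : Set) (T : I → SemitopSemigroup) →
       ((i : I) → Pred (SemitopSemigroup.Carrier (T i)) 0ℓ) →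
       Pred (RawSTS.Carrier (BoxProduct I T)) 0ℓ
ΠSet I T P x = ∀ i → P i (x i)

-- (⇒) The projections of a countable local base of the box product form one at eᵢ. A finite
-- G ⊆ Sᵢ is lifted to the product by filling the other coordinates with points of S so close
-- to e that the lift of y lies in the n-th box whenever y lies in its i-th side; this involves
-- only finitely many n, because y ≠ eᵢ and Tᵢ is Hausdorff.
-- (⇐) Fix boxes inside the members W n of a countable local base of the product. Coordinates in
-- the finite set J range over the finite witnesses of piecewise syndeticity of Aᵢ; every other
-- coordinate is pinned to a point cₙᵢ ∈ Sᵢ. Again a point y of S lies in only finitely many of the
-- boxes, so in a thick coordinate only finitely many translates cₙᵢ + yᵢ must be pushed into Aᵢ by
-- one common x, which is exactly what thickness provides.

module Submission where

open import Defs
open import Level using (0ℓ; suc; Lift)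
import Level
open import Axiom.ExcludedMiddle using (ExcludedMiddle)
open import Axiom.DoubleNegationElimination using (em⇒dne)
open import Data.Empty using (⊥-elim)
open import Data.Unit using (⊤; tt)
open import Data.Nat as ℕ using (ℕ; zero; _≤_; _<_; _≤′_; ≤′-refl; ≤′-step; s≤s)
open import Data.Nat.Properties using (≤⇒≤′; _≤?_; ≰⇒>; m≤n⇒m<n∨m≡n)
open import Data.Product using (Σ-syntax; ∃-syntax; _×_; _,_; proj₁; proj₂)
open import Data.Sum using (inj₁; inj₂)
open import Data.List using (List; []; _∷_; [_]; map; concatMap; filter; upTo)
open import Data.List.Relation.Unary.All as All using (All; []; _∷_)
import Data.List.Relation.Unary.All.Properties as All
open import Data.List.Relation.Unary.Any as Any using (Any; here; there)
import Data.List.Relation.Unary.Any.Properties as Any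
open import Data.List.Membership.Propositional using (_∈_; _∉_)
open import Data.List.Membership.Propositional.Properties
  using (∈-map⁺; ∈-concatMap⁺; ∈-filter⁺; ∈-upTo⁺)
open import Function using (_∘_; id)
open import Function.Bundles using (_⇔_; mk⇔)
open import Relation.Binary.Definitions using (DecidableEquality)
open import Relation.Binary.PropositionalEquality using (_≡_; _≢_; refl; sym; subst)
open import Relation.Nullary using (¬_; Dec; yes; no)
open import Relation.Nullary.Decidable using (map′)
open import Relation.Unary using (Pred; Decidable; _⊆_; _∩_; U)

antitone : {A : Set} {W : ℕ → Pred A 0ℓ} → (∀ n → W (ℕ.suc n) ⊆ W n) →
           ∀ {m n} → m ≤ n → W n ⊆ W m
antitone {W = W} decreasing m≤n = go (≤⇒≤′ m≤n)
  where
  go : ∀ {m n} → m ≤′ n → W n ⊆ W m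
  go ≤′-refl       = id
  go (≤′-step m≤n) = go m≤n ∘ decreasing _

module Classical (em : ExcludedMiddle (suc 0ℓ)) where

  decide : (P : Set) → Dec P
  decide P = map′ Level.lower Level.lift (em {Lift _ P})

  _≟_ : {A : Set} → DecidableEquality A
  x ≟ y = decide (x ≡ y)

module _ {T : RawSTS} where
  open RawSTS T

  module Interior {x N} (N-nbhd : Nbhd x N) where
    interior : Pred Carrier 0ℓ
    interior = proj₁ N-nbhd

    interior-open : Open interior
    interior-open = proj₁ (proj₂ N-nbhd)

    x∈interior : interior x
    x∈interior = proj₁ (proj₂ (proj₂ N-nbhd))

    interior⊆ : interior ⊆ N
    interior⊆ = proj₂ (proj₂ (proj₂ N-nbhd))

  module NearSubsemigroup {e S} (near : IsNearSubsemigroup T e S) where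
    +-closed : ∀ {x y} → S x → S y → S (x + y)
    +-closed = proj₁ (proj₂ near)

    e∉S : ¬ S e
    e∉S = proj₁ (proj₂ (proj₂ near))

    e∈closure : InClosure T e S
    e∈closure = proj₂ (proj₂ (proj₂ near))

module _ (T : SemitopSemigroup) where
  open SemitopSemigroup T

  open-nbhd : ∀ {O x} → Open O → O x → Nbhd x O
  open-nbhd {O} O-open x∈O = O , O-open , x∈O , id

  ⋂< : (ℕ → Pred Carrier 0ℓ) → ℕ → Pred Carrier 0ℓ
  ⋂< O zero      = U
  ⋂< O (ℕ.suc m) = O m ∩ ⋂< O m

  ⋂<-open : ∀ {O} → (∀ n → Open (O n)) → ∀ m → Open (⋂< O m)
  ⋂<-open O-open zero      = open-univ
  ⋂<-open O-open (ℕ.suc m) = open-∩ (O-open m) (⋂<-open O-open m)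

  ⋂<-∋ : ∀ {O x} → (∀ n → O n x) → ∀ m → ⋂< O m x
  ⋂<-∋ x∈O zero      = tt
  ⋂<-∋ x∈O (ℕ.suc m) = x∈O m , ⋂<-∋ x∈O m

  ⋂<-⊆ : ∀ {O} m {n} → n < m → ⋂< O m ⊆ O n
  ⋂<-⊆ (ℕ.suc m) (s≤s n≤m) (x∈Om , x∈⋂) with m≤n⇒m<n∨m≡n n≤m
  ... | inj₁ n<m  = ⋂<-⊆ m n<m x∈⋂
  ... | inj₂ refl = x∈Om

  -- The argument Dec (y ≡ e) only serves to make m a total function of y.
  leaves-base : ∀ {e W} → IsCountableLocalBase raw e W → ∀ y → Dec (y ≡ e) →
                ∃[ m ] (∀ {n} → y ≢ e → W n y → n < m)
  leaves-base _ y (yes y≡e) = zero , λ y≢e _ → ⊥-elim (y≢e y≡e)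
  leaves-base {e} {W} (_ , decreasing , base) y (no y≢e)
    with hausdorff (y≢e ∘ sym)
  ... | Oe , Oy , Oe-open , _ , e∈Oe , y∈Oy , disjoint
    with base Oe (open-nbhd Oe-open e∈Oe)
  ... | m , Wm⊆Oe = m , before-m
    where
    before-m : ∀ {n} → y ≢ e → W n y → n < m
    before-m {n} _ y∈Wn with m ≤? n
    ... | no  m≰n = ≰⇒> m≰n
    ... | yes m≤n = ⊥-elim (disjoint y (Wm⊆Oe (antitone decreasing m≤n y∈Wn)) y∈Oy)

  near-translate : ∀ {e S O N} → IsNearSubsemigroup raw e S → Open O → O e → Nbhd e N →
                   Σ[ c ∈ Carrier ] (N c × S c × O (c + e))
  near-translate {e} {O = O} (idem , _ , _ , e∈clS) O-open e∈O (N' , N'-open , e∈N' , N'⊆N)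
    with e∈clS _ (open-nbhd (open-∩ N'-open (right-cont e O O-open))
                            (e∈N' , subst O (sym idem) e∈O))
  ... | c , (c∈N' , c+e∈O) , c∈S = c , N'⊆N c∈N' , c∈S , c+e∈O

  ThickWithin : Carrier → (S A : Pred Carrier 0ℓ) → Pred Carrier 0ℓ → Set₁
  ThickWithin e S A U₀ =
    ∀ F → FinNonemptySub raw (U₀ ∩ S) F → ∀ V → Nbhd e V →
      Σ[ x ∈ Carrier ] (V x × S x × All (λ t → A (t + x)) F)

  thick-open : ∀ {e S A} → ThickNear raw e S A →
               Σ[ O ∈ Pred Carrier 0ℓ ] (Open O × O e × ThickWithin e S A O)
  thick-open (_ , (O , O-open , e∈O , O⊆U₀) , thick) =
    O , O-open , e∈O ,
    λ F (F≢[] , F⊆O∩S) → thick F (F≢[] , All.map (λ (t∈O , t∈S) → O⊆U₀ t∈O , t∈S) F⊆O∩S)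

module _ {I : Set} (_≟_ : DecidableEquality I) where

  update : ∀ {ℓ} {F : I → Set ℓ} → ((j : I) → F j) → (i : I) → F i → (j : I) → F j
  update t i z j with i ≟ j
  ... | yes refl = z
  ... | no _     = t j

  update-preserves : ∀ {ℓ ℓ′} {F : I → Set ℓ} (Q : ∀ j → F j → Set ℓ′) {t i z} →
                     Q i z → (∀ j → Q j (t j)) → ∀ j → Q j (update t i z j)
  update-preserves Q {i = i} Qz Qt j with i ≟ j
  ... | yes refl = Qz
  ... | no _     = Qt j

  update-same : ∀ {ℓ} {F : I → Set ℓ} (t : (j : I) → F j) i z → update t i z i ≡ z
  update-same t i z with i ≟ i
  ... | yes refl = refl
  ... | no i≢i   = ⊥-elim (i≢i refl)

module Box {I : Set} (T : I → SemitopSemigroup) where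
  module Tᵢ (i : I) = SemitopSemigroup (T i)

  C : I → Set
  C i = Tᵢ.Carrier i

  Π : RawSTS
  Π = BoxProduct I T

  _⊕_ : (x y : (j : I) → C j) → (j : I) → C j
  _⊕_ = RawSTS._+_ Π

  +-syntax : (i : I) → C i → C i → C i
  +-syntax i = Tᵢ._+_ i
  syntax +-syntax i x y = x +[ i ] y

  record BoxNbhd (x : (j : I) → C j) (N : Pred (((j : I) → C j)) 0ℓ) : Set₁ where
    field
      side      : (j : I) → Pred (C j) 0ℓ
      side-open : ∀ j → Tᵢ.Open j (side j)
      ∋x        : ΠSet I T side x
      ⊆N        : ΠSet I T side ⊆ N

    side-nbhd : ∀ j → Tᵢ.Nbhd j (x j) (side j)
    side-nbhd j = open-nbhd (T j) (side-open j) (∋x j)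

  nbhd⇒box : ∀ {x N} → RawSTS.Nbhd Π x N → BoxNbhd x N
  nbhd⇒box {x} (O , O-open , x∈O , O⊆N) with O-open x x∈O
  ... | B , B-open , x∈B , B⊆O = record
    { side = B ; side-open = B-open ; ∋x = x∈B ; ⊆N = O⊆N ∘ B⊆O _ }

  box-open : ∀ {B} → (∀ j → Tᵢ.Open j (B j)) → RawSTS.Open Π (ΠSet I T B)
  box-open B-open y y∈B = _ , B-open , y∈B , λ _ → id

  box-nbhd : ∀ {B x} → (∀ j → Tᵢ.Open j (B j)) → ΠSet I T B x → RawSTS.Nbhd Π x (ΠSet I T B)
  box-nbhd B-open x∈B = _ , box-open B-open , x∈B , id

  projection : Pred (((j : I) → C j)) 0ℓ → (i : I) → Pred (C i) 0ℓ
  projection N i z = Σ[ w ∈ ((j : I) → C j) ] (N w × w i ≡ z)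

  module _ (_≟_ : DecidableEquality I) where

    cylinder-nbhd : ∀ {i x N} → Tᵢ.Nbhd i (x i) N → RawSTS.Nbhd Π x (λ y → N (y i))
    cylinder-nbhd {i} {x} (O , O-open , x∈O , O⊆N) =
      ΠSet I T B , box-open B-open , x∈B ,
      λ {y} y∈B → O⊆N (subst (λ P → P (y i)) (update-same _≟_ (λ _ → U) i O) (y∈B i))
      where
      B : (j : I) → Pred (C j) 0ℓ
      B = update _≟_ (λ _ → U) i O
      B-open : ∀ j → Tᵢ.Open j (B j)
      B-open = update-preserves _≟_ (λ j → Tᵢ.Open j) O-open (λ j → Tᵢ.open-univ j)
      x∈B : ΠSet I T B x
      x∈B = update-preserves _≟_ (λ j P → P (x j)) {t = λ _ → U} x∈O (λ _ → tt)

    side⊆projection : ∀ {x N} (b : BoxNbhd x N) i → BoxNbhd.side b i ⊆ projection N i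
    side⊆projection {x} b i {z} z∈B =
      update _≟_ x i z ,
      ⊆N (update-preserves _≟_ side z∈B ∋x) ,
      update-same _≟_ x i z
      where open BoxNbhd b

    projection-base : ∀ {e W} → IsCountableLocalBase Π e W →
                      ∀ i → IsCountableLocalBase (Tᵢ.raw i) (e i) (λ n → projection (W n) i)
    projection-base {e} {W} (nbhd , decreasing , base) i =
      projection-nbhd ,
      (λ n (w , w∈W , w≡z) → w , decreasing n w∈W , w≡z) ,
      λ N N-nbhd → let (m , Wm⊆N) = base _ (cylinder-nbhd N-nbhd) in
                   m , λ { (w , w∈W , refl) → Wm⊆N w∈W }
      where
      projection-nbhd : ∀ n → Tᵢ.Nbhd i (e i) (projection (W n) i)
      projection-nbhd n = side i , side-open i , ∋x i , side⊆projection b i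
        where b = nbhd⇒box (nbhd n)
              open BoxNbhd b

map-≢[] : ∀ {A B : Set} (f : A → B) {xs} → xs ≢ [] → map f xs ≢ []
map-≢[] f {[]}    xs≢[] = ⊥-elim (xs≢[] refl)
map-≢[] f {_ ∷ _} _     = λ ()

any⇒≢[] : ∀ {A : Set} {P : Pred A 0ℓ} {xs} → Any P xs → xs ≢ []
any⇒≢[] (here _)  = λ ()
any⇒≢[] (there _) = λ ()

module Tuples {I : Set} {C : I → Set} (_≟_ : DecidableEquality I) (L : (j : I) → List (C j)) where
  open import Data.List.Membership.DecPropositional _≟_ using (_∈?_)

  tuples : List I → ((j : I) → C j) → List ((j : I) → C j)
  tuples []      b = [ b ]
  tuples (j ∷ J) b = concatMap (λ t → map (update _≟_ t j) (L j)) (tuples J b)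

  all-tuples : ∀ (P : ∀ j → Pred (C j) 0ℓ) J {b} → (∀ j → P j (b j)) → (∀ j → All (P j) (L j)) →
               All (λ t → ∀ j → P j (t j)) (tuples J b)
  all-tuples P []      Pb PL = Pb ∷ []
  all-tuples P (j ∷ J) Pb PL = All.concat⁺ (All.map⁺ (All.map extend (all-tuples P J Pb PL)))
    where
    extend : ∀ {t} → (∀ k → P k (t k)) → All (λ t → ∀ k → P k (t k)) (map (update _≟_ t j) (L j))
    extend Pt = All.map⁺ (All.map (λ Ps → update-preserves _≟_ P Ps Pt) (PL j))

  any-tuples : ∀ (P : ∀ j → Pred (C j) 0ℓ) J {b} →
               (∀ j → j ∈ J → Any (P j) (L j)) → (∀ j → j ∉ J → P j (b j)) →
               Any (λ t → ∀ j → P j (t j)) (tuples J b)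
  any-tuples P J {b} PL Pb = Any.map fitting⇒P (any-fitting J PL)
    where
    Fitting : List I → Pred ((j : I) → C j) 0ℓ
    Fitting J t = ∀ j → (j ∈ J → P j (t j)) × (j ∉ J → t j ≡ b j)

    fitting⇒P : ∀ {t} → Fitting J t → ∀ j → P j (t j)
    fitting⇒P fits j with j ∈? J
    ... | yes j∈J = proj₁ (fits j) j∈J
    ... | no  j∉J = subst (P j) (sym (proj₂ (fits j) j∉J)) (Pb j j∉J)

    any-fitting : ∀ J → (∀ j → j ∈ J → Any (P j) (L j)) → Any (Fitting J) (tuples J b)
    any-fitting []      _  = here (λ j → (λ ()) , λ _ → refl)
    any-fitting (j ∷ J) PL =
      Any.concatMap⁺ _ (Any.map (λ fits → Any.map⁺ (Any.map (extend fits) (PL j (here refl))))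
                                (any-fitting J (λ k → PL k ∘ there)))
      where
      extend : ∀ {t s} → Fitting J t → P j s → Fitting (j ∷ J) (update _≟_ t j s)
      extend fits Ps k with j ≟ k
      ... | yes refl = (λ _ → Ps) , λ j∉ → ⊥-elim (j∉ (here refl))
      ... | no  j≢k  = (λ { (here refl) → ⊥-elim (j≢k refl) ; (there k∈J) → proj₁ (fits k) k∈J })
                     , λ k∉ → proj₂ (fits k) (k∉ ∘ there)

  tuples-≢[] : ∀ J {b} → (∀ j → L j ≢ []) → tuples J b ≢ []
  tuples-≢[] J L≢[] = any⇒≢[] (any-tuples (λ _ _ → ⊤) J (λ j _ → nonempty (L≢[] j)) (λ _ _ → tt))
    where
    nonempty : ∀ {A : Set} {xs : List A} → xs ≢ [] → Any (λ _ → ⊤) xs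
    nonempty {xs = []}    xs≢[] = ⊥-elim (xs≢[] refl)
    nonempty {xs = _ ∷ _} _     = here tt

module _ (T : RawSTS) where
  open RawSTS T

  record PiecewiseSyndetic (e : Carrier) (S A : Pred Carrier 0ℓ) : Set₁ where
    field
      W        : ℕ → Pred Carrier 0ℓ
      W-base   : IsCountableLocalBase T e W
      F        : ℕ → List Carrier
      V        : ℕ → Pred Carrier 0ℓ
      F-finite : ∀ n → FinNonemptySub T (W n ∩ S) (F n)
      V-nbhd   : ∀ n → Nbhd e (V n)
      V⊆W      : ∀ n → V n ⊆ W n
      syndetic : ∀ G → FinNonemptySub T S G → ∀ O → Nbhd e O →
                 Σ[ x ∈ Carrier ] (O x × S x ×
                   (∀ n y → y ∈ G → V n y → Any (λ t → A (t + (y + x))) (F n)))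

  unpack : ∀ {e S A} → PiecewiseSyndeticNear T e S A → PiecewiseSyndetic e S A
  unpack (W , W-base , F , V , F-finite , V-nbhd , V⊆W , syndetic) =
    record { W = W ; W-base = W-base ; F = F ; V = V ; F-finite = F-finite
           ; V-nbhd = V-nbhd ; V⊆W = V⊆W ; syndetic = syndetic }

  pack : ∀ {e S A} → PiecewiseSyndetic e S A → PiecewiseSyndeticNear T e S A
  pack p = W , W-base , F , V , F-finite , V-nbhd , V⊆W , syndetic
    where open PiecewiseSyndetic p

module Exit (em : ExcludedMiddle (suc 0ℓ)) {I : Set} (T : I → SemitopSemigroup)
  {S : (i : I) → Pred (SemitopSemigroup.Carrier (T i)) 0ℓ} {e : (i : I) → SemitopSemigroup.Carrier (T i)}
  (near : ∀ i → IsNearSubsemigroup (SemitopSemigroup.raw (T i)) (e i) (S i))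
  {W : ℕ → Pred ((i : I) → SemitopSemigroup.Carrier (T i)) 0ℓ}
  (W-base : IsCountableLocalBase (BoxProduct I T) e W) (i : I) where
  open Classical em
  open Box T

  exit : C i → ℕ
  exit y = proj₁ (leaves-base (T i) (projection-base _≟_ W-base i) y (y ≟ e i))

  before-exit : ∀ {y n} → S i y → projection (W n) i y → n < exit y
  before-exit {y} y∈S = proj₂ (leaves-base (T i) (projection-base _≟_ W-base i) y (y ≟ e i))
    (λ y≡e → NearSubsemigroup.e∉S (near i) (subst (S i) y≡e y∈S))

module Coordinate (em : ExcludedMiddle (suc 0ℓ)) {I : Set} (T : I → SemitopSemigroup)
  {S A : (i : I) → Pred (SemitopSemigroup.Carrier (T i)) 0ℓ} {e : (i : I) → SemitopSemigroup.Carrier (T i)}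
  (near : ∀ i → IsNearSubsemigroup (SemitopSemigroup.raw (T i)) (e i) (S i))
  (psn : PiecewiseSyndetic (BoxProduct I T) e (ΠSet I T S) (ΠSet I T A)) (i : I) where
  open Classical em
  open Box T
  open PiecewiseSyndetic psn
  open Tᵢ i using (_+_)

  module Vbox n = BoxNbhd (nbhd⇒box (V-nbhd n))

  Wᵢ Vᵢ : ℕ → Pred (C i) 0ℓ
  Wᵢ n = projection (W n) i
  Vᵢ n = Vbox.side n i

  Fᵢ : ℕ → List (C i)
  Fᵢ n = map (λ t → t i) (F n)

  Vᵢ⊆Wᵢ : ∀ n → Vᵢ n ⊆ Wᵢ n
  Vᵢ⊆Wᵢ n y∈V with side⊆projection _≟_ (nbhd⇒box (V-nbhd n)) i y∈V
  ... | w , w∈V , w≡y = w , V⊆W n w∈V , w≡y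

  open Exit em T near W-base i

  V-before-exit : ∀ {y n} → S i y → Vᵢ n y → n < exit y
  V-before-exit y∈S y∈V = before-exit y∈S (Vᵢ⊆Wᵢ _ y∈V)

  companion : ∀ m (j : I) → Σ[ s ∈ C j ] (⋂< (T j) (λ n → Vbox.side n j) m s × S j s)
  companion m j = NearSubsemigroup.e∈closure (near j) _
    (open-nbhd (T j) (⋂<-open (T j) (λ n → Vbox.side-open n j) m) (⋂<-∋ (T j) (λ n → Vbox.∋x n j) m))

  -- Off coordinate i, lift y lies in the boxes of V n for all n < exit y,
  -- so that lift y ∈ V n whenever y ∈ Vᵢ n.
  lift : C i → (j : I) → C j
  lift y = update _≟_ (λ j → proj₁ (companion (exit y) j)) i y

  lift-S : ∀ {y} → S i y → ΠSet I T S (lift y)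
  lift-S y∈S = update-preserves _≟_ S y∈S (λ j → proj₂ (proj₂ (companion _ j)))

  lift-V : ∀ {y n} → S i y → Vᵢ n y → V n (lift y)
  lift-V {y} {n} y∈S y∈V = Vbox.⊆N n (update-preserves _≟_ (λ j → Vbox.side n j) y∈V
    (λ j → ⋂<-⊆ (T j) (exit y) (V-before-exit y∈S y∈V) (proj₁ (proj₂ (companion (exit y) j)))))

  syndeticᵢ : ∀ G → FinNonemptySub (Tᵢ.raw i) (S i) G → ∀ O → Tᵢ.Nbhd i (e i) O →
              Σ[ x ∈ C i ] (O x × S i x ×
                (∀ n y → y ∈ G → Vᵢ n y → Any (λ t → A i (t + (y + x))) (Fᵢ n)))
  syndeticᵢ G (G≢[] , G⊆S) O O-nbhd
    with syndetic (map lift G) (map-≢[] lift G≢[] , All.map⁺ (All.map lift-S G⊆S))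
                  _ (cylinder-nbhd _≟_ O-nbhd)
  ... | x , x∈O , x∈S , hits = x i , x∈O , x∈S i , hitsᵢ
    where
    hitsᵢ : ∀ n y → y ∈ G → Vᵢ n y → Any (λ t → A i (t + (y + x i))) (Fᵢ n)
    hitsᵢ n y y∈G y∈V = Any.map⁺ (Any.map (λ {t} t+y+x∈A →
        subst (λ z → A i (t i + (z + x i))) (update-same _≟_ _ i y) (t+y+x∈A i))
      (hits n (lift y) (∈-map⁺ lift y∈G) (lift-V (All.lookup G⊆S y∈G) y∈V)))

  piecewiseSyndeticᵢ : PiecewiseSyndetic (Tᵢ.raw i) (e i) (S i) (A i)
  piecewiseSyndeticᵢ = record
    { W = Wᵢ ; W-base = projection-base _≟_ W-base i ; F = Fᵢ ; V = Vᵢ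
    ; F-finite = λ n → map-≢[] _ (proj₁ (F-finite n)) ,
                       All.map⁺ (All.map (λ (t∈W , t∈S) → (_ , t∈W , refl) , t∈S i) (proj₂ (F-finite n)))
    ; V-nbhd = λ n → Vbox.side-nbhd n i ; V⊆W = Vᵢ⊆Wᵢ ; syndetic = syndeticᵢ }

module Product (em : ExcludedMiddle (suc 0ℓ)) {I : Set} (T : I → SemitopSemigroup)
  {S A : (i : I) → Pred (SemitopSemigroup.Carrier (T i)) 0ℓ} {e : (i : I) → SemitopSemigroup.Carrier (T i)}
  (near : ∀ i → IsNearSubsemigroup (SemitopSemigroup.raw (T i)) (e i) (S i))
  {W : ℕ → Pred ((i : I) → SemitopSemigroup.Carrier (T i)) 0ℓ}
  (W-base : IsCountableLocalBase (BoxProduct I T) e W)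
  (J : List I) (J-covers : ∀ i → ¬ ThickNear (SemitopSemigroup.raw (T i)) (e i) (S i) (A i) → i ∈ J)
  (psn : ∀ i → PiecewiseSyndetic (SemitopSemigroup.raw (T i)) (e i) (S i) (A i)) where
  open Classical em
  open Box T
  open import Data.List.Membership.DecPropositional (_≟_ {I}) using (_∈?_)
  module P i = PiecewiseSyndetic (psn i)
  module Near i = NearSubsemigroup (near i)
  module Wbox n = BoxNbhd (nbhd⇒box (proj₁ W-base n))
  module Exitᵢ = Exit em T near W-base

  record ThickNbhd (i : I) : Set₁ where
    field
      Θ       : Pred (C i) 0ℓ
      Θ-open  : Tᵢ.Open i Θ
      e∈Θ     : Θ (e i)
      Θ-thick : i ∉ J → ThickWithin (T i) (e i) (S i) (A i) Θ

  thickNbhd : ∀ i → ThickNbhd i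
  thickNbhd i with i ∈? J
  ... | yes i∈J =
    record { Θ = U ; Θ-open = Tᵢ.open-univ i ; e∈Θ = tt ; Θ-thick = λ i∉J → ⊥-elim (i∉J i∈J) }
  ... | no  i∉J with thick-open (T i) {S = S i} {A = A i} (em⇒dne em (i∉J ∘ J-covers i))
  ...   | O , O-open , e∈O , thick =
    record { Θ = O ; Θ-open = O-open ; e∈Θ = e∈O ; Θ-thick = λ _ → thick }
  open module Θᵢ i = ThickNbhd (thickNbhd i)

  level-spec : ∀ i n → Σ[ m ∈ ℕ ] (P.W i m ⊆ Wbox.side n i)
  level-spec i n = proj₂ (proj₂ (P.W-base i)) _ (Wbox.side-nbhd n i)

  level : I → ℕ → ℕ
  level i n = proj₁ (level-spec i n)

  level-⊆ : ∀ i n → P.W i (level i n) ⊆ Wbox.side n i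
  level-⊆ i n = proj₂ (level-spec i n)

  -- c n i + e i ∈ Θ i makes the left translate of Θ i by c n i an open neighbourhood of e i.
  pivot : ∀ n i → Σ[ c ∈ C i ] (Wbox.side n i c × S i c × Θ i (c +[ i ] e i))
  pivot n i = near-translate (T i) (near i) (Θ-open i) (e∈Θ i) (Wbox.side-nbhd n i)

  c : ℕ → (i : I) → C i
  c n i = proj₁ (pivot n i)

  c∈W : ∀ n i → Wbox.side n i (c n i)
  c∈W n i = proj₁ (proj₂ (pivot n i))

  c∈S : ∀ n i → S i (c n i)
  c∈S n i = proj₁ (proj₂ (proj₂ (pivot n i)))

  c+e∈Θ : ∀ n i → Θ i (c n i +[ i ] e i)
  c+e∈Θ n i = proj₂ (proj₂ (proj₂ (pivot n i)))

  module Vo i m = Interior {T = Tᵢ.raw i} (P.V-nbhd i m)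
  open Vo using (interior)

  Q : ℕ → (i : I) → Pred (C i) 0ℓ
  Q n i = Wbox.side n i ∩ (interior i (level i n) ∩ (λ y → Θ i (c n i +[ i ] y)))

  Q-open : ∀ n i → Tᵢ.Open i (Q n i)
  Q-open n i = Tᵢ.open-∩ i (Wbox.side-open n i) (Tᵢ.open-∩ i (Vo.interior-open i (level i n))
                 (Tᵢ.left-cont i (c n i) (Θ i) (Θ-open i)))

  e∈Q : ∀ n i → Q n i (e i)
  e∈Q n i = Wbox.∋x n i , Vo.x∈interior i (level i n) , c+e∈Θ n i

  V : ℕ → Pred ((i : I) → C i) 0ℓ
  V n = ΠSet I T (Q n)

  L : ℕ → (i : I) → List (C i)
  L n i = P.F i (level i n)

  F : ℕ → List ((i : I) → C i)
  F n = Tuples.tuples _≟_ (L n) J (c n)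

  F-finite : ∀ n → FinNonemptySub (BoxProduct I T) (W n ∩ ΠSet I T S) (F n)
  F-finite n =
    Tuples.tuples-≢[] _≟_ (L n) J (λ i → proj₁ (P.F-finite i (level i n))) ,
    All.map (λ t∈ → Wbox.⊆N n (proj₁ ∘ t∈) , proj₂ ∘ t∈)
      (Tuples.all-tuples _≟_ (L n) (λ i → Wbox.side n i ∩ S i) J
        (λ i → c∈W n i , c∈S n i)
        (λ i → All.map (λ (t∈W , t∈S) → level-⊆ i n t∈W , t∈S) (proj₂ (P.F-finite i (level i n)))))

  module _ (G : List ((i : I) → C i)) (G≢[] : G ≢ []) (G⊆S : All (ΠSet I T S) G)
           {O} (O-nbhd : RawSTS.Nbhd (BoxProduct I T) e O) where
    module Obox = BoxNbhd (nbhd⇒box O-nbhd)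

    Gᵢ : (i : I) → List (C i)
    Gᵢ i = map (λ g → g i) G

    syndetic-coordinate : ∀ i → Σ[ x ∈ C i ] (Obox.side i x × S i x ×
      (∀ n {y} → y ∈ G → V n y → Any (λ t → A i (t +[ i ] (y i +[ i ] x))) (L n i)))
    syndetic-coordinate i
      with P.syndetic i (Gᵢ i) (map-≢[] _ G≢[] , All.map⁺ (All.map (λ g∈S → g∈S i) G⊆S))
                        _ (Obox.side-nbhd i)
    ... | x , x∈O , x∈S , hits =
      x , x∈O , x∈S , λ n y∈G y∈V → hits _ _ (∈-map⁺ _ y∈G) (Vo.interior⊆ i _ (proj₁ (proj₂ (y∈V i))))

    ΘS? : ∀ i → Decidable (Θ i ∩ S i)
    ΘS? i z = decide ((Θ i ∩ S i) z)

    -- y ∈ V n forces n < exit (y i), so only these translates c n i + y i can ever be required.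
    candidates : ∀ i → List (C i)
    candidates i = concatMap (λ g → map (λ n → c n i +[ i ] g i) (upTo (Exitᵢ.exit i (g i)))) G

    thick-coordinate : ∀ i → i ∉ J → Σ[ x ∈ C i ] (Obox.side i x × S i x ×
      (∀ n {y} → y ∈ G → V n y → A i (c n i +[ i ] (y i +[ i ] x))))
    thick-coordinate i i∉J
      with Near.e∈closure i _ (open-nbhd (T i) (Θ-open i) (e∈Θ i))
    ... | z₀ , z₀∈Θ , z₀∈S
      -- z₀ only keeps the list nonempty.
      with Θ-thick i i∉J (z₀ ∷ filter (ΘS? i) (candidates i))
                       ((λ ()) , (z₀∈Θ , z₀∈S) ∷ All.all-filter (ΘS? i) (candidates i))
             _ (Obox.side-nbhd i)
    ... | x , x∈O , x∈S , hits = x , x∈O , x∈S , hit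
      where
      hit : ∀ n {y} → y ∈ G → V n y → A i (c n i +[ i ] (y i +[ i ] x))
      hit n {y} y∈G y∈V = subst (A i) (Tᵢ.+-assoc i _ _ _) (All.lookup hits (there translate∈))
        where
        y∈S : S i (y i)
        y∈S = All.lookup G⊆S y∈G i
        n<exit : n < Exitᵢ.exit i (y i)
        n<exit = Exitᵢ.before-exit i y∈S
                   (side⊆projection _≟_ (nbhd⇒box (proj₁ W-base n)) i (proj₁ (y∈V i)))
        translate∈ : c n i +[ i ] y i ∈ filter (ΘS? i) (candidates i)
        translate∈ = ∈-filter⁺ (ΘS? i)
          (∈-concatMap⁺ _ (Any.map (λ { refl → ∈-map⁺ _ (∈-upTo⁺ n<exit) }) y∈G))
          (proj₂ (proj₂ (y∈V i)) , Near.+-closed i (c∈S n i) y∈S)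

    Coordinatewise : (i : I) → C i → Set
    Coordinatewise i x = ∀ n {y} → y ∈ G → V n y →
      (i ∈ J → Any (λ t → A i (t +[ i ] (y i +[ i ] x))) (L n i)) ×
      (i ∉ J → A i (c n i +[ i ] (y i +[ i ] x)))

    coordinate : ∀ i → Σ[ x ∈ C i ] (Obox.side i x × S i x × Coordinatewise i x)
    coordinate i = by-membership (i ∈? J)
      where
      by-membership : Dec (i ∈ J) → Σ[ x ∈ C i ] (Obox.side i x × S i x × Coordinatewise i x)
      by-membership (yes i∈J) = let (x , x∈O , x∈S , hits) = syndetic-coordinate i in
        x , x∈O , x∈S , λ n y∈G y∈V → (λ _ → hits n y∈G y∈V) , λ i∉J → ⊥-elim (i∉J i∈J)
      by-membership (no i∉J) = let (x , x∈O , x∈S , hits) = thick-coordinate i i∉J in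
        x , x∈O , x∈S , λ n y∈G y∈V → (λ i∈J → ⊥-elim (i∉J i∈J)) , λ _ → hits n y∈G y∈V

    x : (i : I) → C i
    x i = proj₁ (coordinate i)

    x-good : ∀ i → Coordinatewise i (x i)
    x-good i = proj₂ (proj₂ (proj₂ (coordinate i)))

    hits : ∀ n y → y ∈ G → V n y → Any (λ t → ΠSet I T A (t ⊕ (y ⊕ x))) (F n)
    hits n y y∈G y∈V =
      Tuples.any-tuples _≟_ (L n) (λ i s → A i (s +[ i ] (y i +[ i ] x i))) J
        (λ i → proj₁ (x-good i n y∈G y∈V)) (λ i → proj₂ (x-good i n y∈G y∈V))

    syndetic : Σ[ z ∈ ((i : I) → C i) ] (O z × ΠSet I T S z ×
      (∀ n y → y ∈ G → V n y → Any (λ t → ΠSet I T A (t ⊕ (y ⊕ z))) (F n)))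
    syndetic =
      x , Obox.⊆N (λ i → proj₁ (proj₂ (coordinate i))) ,
      (λ i → proj₁ (proj₂ (proj₂ (coordinate i)))) , hits

  piecewiseSyndeticΠ : PiecewiseSyndetic (BoxProduct I T) e (ΠSet I T S) (ΠSet I T A)
  piecewiseSyndeticΠ = record
    { W = W ; W-base = W-base ; F = F ; V = V ; F-finite = F-finite
    ; V-nbhd = λ n → box-nbhd (Q-open n) (e∈Q n)
    ; V⊆W = λ n y∈V → Wbox.⊆N n (proj₁ ∘ y∈V)
    ; syndetic = λ G (G≢[] , G⊆S) _ O-nbhd → syndetic G G≢[] G⊆S O-nbhd }

theorem2p24 : ExcludedMiddle (suc 0ℓ) →
    (I : Set) (T : I → SemitopSemigroup)
    (S A : (i : I) → Pred (SemitopSemigroup.Carrier (T i)) 0ℓ)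
    (e : (i : I) → SemitopSemigroup.Carrier (T i)) →
    (∀ i → IsNearSubsemigroup (SemitopSemigroup.raw (T i)) (e i) (S i)) →
    (∀ i → A i ⊆ S i) →
    HasCountableLocalBase (BoxProduct I T) e →
    (Σ[ J ∈ List I ] (∀ i → ¬ ThickNear (SemitopSemigroup.raw (T i)) (e i) (S i) (A i) → i ∈ J)) →
    (PiecewiseSyndeticNear (BoxProduct I T) e (ΠSet I T S) (ΠSet I T A)
      ⇔ (∀ i → PiecewiseSyndeticNear (SemitopSemigroup.raw (T i)) (e i) (S i) (A i)))
theorem2p24 em I T S A e near _ (W , W-base) (J , J-covers) = mk⇔
  (λ psn i → pack _ (Coordinate.piecewiseSyndeticᵢ em T {A = A} near (unpack _ psn) i))
  (λ psn → pack _ (Product.piecewiseSyndeticΠ em T {A = A} near W-base J J-covers (unpack _ ∘ psn)))
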